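{- For every positive integer $n$, $$p_{\mathcal D}(n)=1+p_{\mathcal E_0}(n)+p_{\mathcal E_1}(n)+p_{\mathcal E_D}(n)+\delta(n),$$ where $\delta(n)=1$ if $3$ divides $n$ and $\delta(n)=0$ otherwise. That is, the number of partitions of $n$ into distinct parts equals $1$ plus the number of partitions of $n$ (of dimension $\ge2$) in which all parts have multiplicity one except the largest, which has multiplicity two, plus the number in which all parts have multiplicity one except the smallest, which has multiplicity two, plus the number in which all parts have multiplicity one except the largest and smallest, each of which has multiplicity two, plus an additional $1$ if $n$ is divisible by $3$.
   Context: A partition is written $(\lambda_1,\dots,\lambda_m)\times[k_1,\dots,k_m]$, where $m\ge1$, the parts $\lambda_i$ are integers with $\lambda_1>\dots>\lambda_m>0$ and the multiplicities $k_i$ are positive integers; its size is $\sum k_i\lambda_i$. For a set $S$ of partitions, $p_S(n)$ is the number of elements of $S$ of size $n$. $\mathcal D$ is the set of partitions with all $k_i=1$. Among partitions of dimension $m\ge2$: $\mathcal E_0$ is the set with $k_1=2$ and $k_i=1$ for $i\ge2$; $\mathcal E_1$ is the set with $k_m=2$ and $k_i=1$ for $i<m$; $\mathcal E_D$ is the set with $k_1=k_m=2$ and $k_i=1$ for $1<i<m$. -}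

module Defs where

open import Data.Nat using (ℕ; zero; suc; _+_; _*_; _∸_; _<_; _≤_)
open import Data.Nat.Divisibility using (_∣?_)
open import Data.Product using (Σ; Σ-syntax; _×_; _,_; proj₁; proj₂)
open import Data.Nat.ListAction using (sum)
open import Data.List using (List; []; _∷_; map; length; replicate; _++_; [_])
open import Data.List.Relation.Unary.All using (All)
open import Data.List.Relation.Unary.Linked using (Linked)
open import Data.Fin using (Fin)
open import Data.Bool using (if_then_else_)
open import Relation.Nullary.Decidable using (does)
open import Relation.Binary.PropositionalEquality using (_≡_)
open import Function.Bundles using (_↔_)

-- A partition (λ₁,…,λₘ)×[k₁,…,kₘ] is represented by the list of pairs
-- (λᵢ , kᵢ), i = 1..m, in order.
PartMult : Set
PartMult = ℕ × ℕ

part : PartMult → ℕ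
part = proj₁

mult : PartMult → ℕ
mult = proj₂

record Valid (xs : List PartMult) : Set where
  field
    dimPos    : 1 ≤ length xs
    decr      : Linked (λ p q → part q < part p) xs
    partsPos  : All (λ p → 0 < part p) xs
    multsPos  : All (λ p → 0 < mult p) xs

Partition : Set
Partition = Σ (List PartMult) Valid

dim : Partition → ℕ
dim (xs , _) = length xs

mults : Partition → List ℕ
mults (xs , _) = map mult xs

size : Partition → ℕ
size (xs , _) = sum (map (λ p → mult p * part p) xs)

InD : Partition → Set
InD π = mults π ≡ replicate (dim π) 1

InE0 : Partition → Set
InE0 π = 2 ≤ dim π × mults π ≡ 2 ∷ replicate (dim π ∸ 1) 1

InE1 : Partition → Set
InE1 π = 2 ≤ dim π × mults π ≡ replicate (dim π ∸ 1) 1 ++ [ 2 ]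

InED : Partition → Set
InED π = 2 ≤ dim π × mults π ≡ 2 ∷ (replicate (dim π ∸ 2) 1 ++ [ 2 ])

OfSize : (Partition → Set) → ℕ → Set
OfSize S n = Σ[ π ∈ Partition ] (size π ≡ n × S π)

_HasCard_ : Set → ℕ → Set
A HasCard k = Fin k ↔ A

δ : ℕ → ℕ
δ n = if does (3 ∣? n) then 1 else 0

{-# OPTIONS --safe #-}
-- Apart from the one-part partition (n), a partition of n into distinct parts is a chain
-- T > b > ⋯ > z of at least two parts (b = z when there are only two). Compare the excess
-- d = T − b of the largest part over the second with the smallest part z:
--   d < z : b > ⋯ > z > d with b doubled, a partition in ℰ₀;
--   d > z : T − z > b > ⋯ > z with z doubled, a partition in ℰ₁;
--   d = z : b > ⋯ > z with b and z doubled, a partition in ℰ_D, unless the chain is 2z > z,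
--           i.e. n = 3z, the one extra partition counted by δ(n).
-- Sizes are preserved, and the map is invertible because T is always the sum of the largest
-- and the smallest part of the image. All sets involved are finite (decidable subsets of the
-- lists of length ≤ n with entries ≤ n), so the bijection yields the identity of cardinalities.
module Submission where

open import Defs
open import Data.Bool using (if_then_else_)
open import Data.Bool.Properties using (T-irrelevant; T?)
open import Data.Empty using (⊥; ⊥-elim)
open import Data.Fin using (Fin)
open import Data.Fin.Permutation using (↔⇒≡)
open import Data.Fin.Properties using (0↔⊥; 1↔⊤; +↔⊎)
open import Data.List using (List; []; _∷_; _++_; [_]; map; length; replicate; upTo; cartesianProduct; cartesianProductWith)
open import Data.List.Membership.Propositional using (_∈_)
open import Data.List.Membership.Propositional.Properties using (∈-cartesianProductWith⁺; ∈-cartesianProduct⁺; ∈-upTo⁺)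
open import Data.List.Properties using (∷-injectiveˡ; ∷-injectiveʳ; ≡-dec)
open import Data.List.Relation.Unary.All as All using (All; []; _∷_; all?)
open import Data.List.Relation.Unary.Any using (here; there)
open import Data.List.Relation.Unary.Any.Properties using (¬Any[])
open import Data.List.Relation.Unary.Linked as Linked using (Linked; []; [-]; _∷_)
open import Data.Nat using (ℕ; zero; suc; _+_; _*_; _∸_; _≤_; _<_; _≟_; _≤?_; _<?_; s≤s; z≤n; NonZero)
open import Data.Nat.Base using (>-nonZero)
open import Data.Nat.Divisibility using (_∣_; _∣?_; divides)
open import Data.Nat.ListAction using (sum)
open import Data.Nat.ListAction.Properties using (sum-++)
open import Data.Nat.Properties
  using (≤-irrelevant; <-irrelevant; ≡-irrelevant; ≤-trans; <-trans; <-≤-trans; <⇒≤; <-cmp;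
         +-comm; +-assoc; +-identityʳ; *-identityˡ; +-mono-≤; +-monoˡ-<;
         m≤m+n; m≤n+m; m<m+n; m≤n*m; m≤m*n; *-cancelʳ-≡;
         m∸n≤m; m∸n+n≡m; m+n∸m≡n; m+n∸n≡m; m<n⇒0<n∸m; m+n≤o⇒m≤o∸n; m≤o∸n⇒m+n≤o)
open import Data.Nat.Tactic.RingSolver using (solve-∀)
import Data.Product.Properties as Product
open import Data.Product using (Σ; Σ-syntax; _×_; _,_; proj₁; proj₂)
open import Data.Sum using (_⊎_; inj₁; inj₂)
open import Data.Sum.Function.Propositional using (_⊎-↔_)
open import Data.Unit using (⊤; tt)
open import Function using (_∘_)
open import Function.Bundles using (_↔_; mk↔ₛ′)
open import Function.Construct.Composition using (_↔-∘_)
open import Function.Construct.Identity using (↔-id)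
open import Function.Construct.Symmetry using (↔-sym)
open import Function.Related.TypeIsomorphisms using (Σ-assoc)
open import Level using (0ℓ)
open import Axiom.UniquenessOfIdentityProofs using (module Decidable⇒UIP)
open import Relation.Binary.Definitions using (DecidableEquality; Tri; tri<; tri≈; tri>)
open import Relation.Binary.PropositionalEquality
  using (_≡_; refl; sym; trans; cong; cong₂; subst; ≡-≟-identity; module ≡-Reasoning)
open import Relation.Nullary using (Dec; yes; no; does; Irrelevant; contradiction)
open import Relation.Nullary.Decidable using (map′; _×-dec_; True; True-↔; False; fromWitnessFalse; toWitnessFalse)
import Relation.Unary as U

-- Counting finite types

Finite : Set → Set
Finite A = Σ[ k ∈ ℕ ] Fin k ↔ A

Fin+↔⊎ : ∀ {m n} {A B : Set} → Fin m ↔ A → Fin n ↔ B → Fin (m + n) ↔ (A ⊎ B)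
Fin+↔⊎ f g = (f ⊎-↔ g) ↔-∘ +↔⊎

finite-⊎ : ∀ {A B} → Finite A → Finite B → Finite (A ⊎ B)
finite-⊎ (m , f) (n , g) = m + n , Fin+↔⊎ f g

finite-↔ : ∀ {A B} → A ↔ B → Finite A → Finite B
finite-↔ e (k , f) = k , e ↔-∘ f

Fin-if-does↔ : ∀ {P : Set} (P? : Dec P) → Irrelevant P → Fin (if does P? then 1 else 0) ↔ P
Fin-if-does↔ P? irr = True-↔ P? irr ↔-∘ Fin↔True P?
  where
  Fin↔True : (P? : Dec _) → Fin (if does P? then 1 else 0) ↔ True P?
  Fin↔True (yes _) = 1↔⊤
  Fin↔True (no _)  = 0↔⊥

module _ {A : Set} (_≟_ : DecidableEquality A) where

  Σ-split : ∀ {P : U.Pred A 0ℓ} (y : A) → Σ A P ↔ (P y ⊎ Σ[ x ∈ A ] (P x × False (x ≟ y)))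
  Σ-split {P} y = mk↔ₛ′ to from to∘from from∘to
    where
    to-with : ∀ {x} → P x → Dec (x ≡ y) → P y ⊎ Σ[ x ∈ A ] (P x × False (x ≟ y))
    to-with p (yes refl) = inj₁ p
    to-with p (no x≢y)   = inj₂ (_ , p , fromWitnessFalse x≢y)

    to : Σ A P → P y ⊎ Σ[ x ∈ A ] (P x × False (x ≟ y))
    to (x , p) = to-with p (x ≟ y)

    from : P y ⊎ Σ[ x ∈ A ] (P x × False (x ≟ y)) → Σ A P
    from (inj₁ p)           = y , p
    from (inj₂ (x , p , _)) = x , p

    to∘from : ∀ s → to (from s) ≡ s
    to∘from (inj₁ p) rewrite ≡-≟-identity _≟_ {y} refl = refl
    to∘from (inj₂ (x , p , x≢y)) = to-with-distinct p x≢y (x ≟ y)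
      where
      to-with-distinct : ∀ {x} (p : P x) (x≢y : False (x ≟ y)) (x≟y : Dec (x ≡ y)) →
                         to-with p x≟y ≡ inj₂ (x , p , x≢y)
      to-with-distinct p x≢y (yes refl) = contradiction refl (toWitnessFalse x≢y)
      to-with-distinct p x≢y (no _)     = cong (λ q → inj₂ (_ , p , q)) (T-irrelevant _ x≢y)

    from∘to : ∀ s → from (to s) ≡ s
    from∘to (x , p) with x ≟ y
    ... | yes refl = refl
    ... | no _     = refl

  finite-Σ : ∀ {P : U.Pred A 0ℓ} (xs : List A) → U.Decidable P → U.Irrelevant P → (∀ {x} → P x → x ∈ xs) →
             Finite (Σ A P)
  finite-Σ {P} [] _ _ covered = 0 , mk↔ₛ′ (λ ()) (⊥-elim ∘ uncovered) (⊥-elim ∘ uncovered) (λ ())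
    where
    uncovered : Σ A P → ⊥
    uncovered (_ , p) = ¬Any[] (covered p)
  finite-Σ {P} (y ∷ xs) P? irr covered =
    finite-↔ (↔-sym (Σ-split y)) (finite-⊎ (_ , Fin-if-does↔ (P? y) irr) (finite-Σ xs P≢y? irr≢y covered≢y))
    where
    P≢y? : U.Decidable (λ x → P x × False (x ≟ y))
    P≢y? x = P? x ×-dec T? _

    irr≢y : U.Irrelevant (λ x → P x × False (x ≟ y))
    irr≢y (p , f) (q , g) = cong₂ _,_ (irr p q) (T-irrelevant f g)

    covered≢y : ∀ {x} → P x × False (x ≟ y) → x ∈ xs
    covered≢y (p , x≢y) with covered p
    ... | here refl  = contradiction refl (toWitnessFalse x≢y)
    ... | there x∈xs = x∈xs

-- Finite sets of partitions of a fixed size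

Valid-irrelevant : ∀ {xs} → Irrelevant (Valid xs)
Valid-irrelevant record { dimPos = a ; decr = b ; partsPos = c ; multsPos = d }
                 record { dimPos = a′ ; decr = b′ ; partsPos = c′ ; multsPos = d′ }
  rewrite ≤-irrelevant a a′ | Linked.irrelevant <-irrelevant b b′
        | All.irrelevant <-irrelevant c c′ | All.irrelevant <-irrelevant d d′ = refl

valid? : ∀ xs → Dec (Valid xs)
valid? xs = map′ (λ (a , b , c , d) → record { dimPos = a ; decr = b ; partsPos = c ; multsPos = d })
                 (λ v → Valid.dimPos v , Valid.decr v , Valid.partsPos v , Valid.multsPos v)
                 (1 ≤? length xs ×-dec Linked.linked? (λ p q → part q <? part p) xs ×-dec
                  all? (λ p → 0 <? part p) xs ×-dec all? (λ p → 0 <? mult p) xs)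

List≡-irrelevant : ∀ {ks ls : List ℕ} → Irrelevant (ks ≡ ls)
List≡-irrelevant = Decidable⇒UIP.≡-irrelevant (≡-dec _≟_)

≤×≡-irrelevant : ∀ {m n} {ks ls : List ℕ} → Irrelevant (m ≤ n × ks ≡ ls)
≤×≡-irrelevant (a , b) (c , d) = cong₂ _,_ (≤-irrelevant a c) (List≡-irrelevant b d)

OfSize-≡ : ∀ {S n} → (∀ π → Irrelevant (S π)) → {x y : OfSize S n} →
           proj₁ (proj₁ x) ≡ proj₁ (proj₁ y) → x ≡ y
OfSize-≡ S-irrelevant {(xs , v) , s , p} {(.xs , v′) , s′ , p′} refl with Valid-irrelevant v v′
... | refl = cong₂ (λ s p → (xs , v) , s , p) (≡-irrelevant s s′) (S-irrelevant _ p p′)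

OfSize-cong : ∀ {S S′ : Partition → Set} {n} → (∀ π → Irrelevant (S π)) → (∀ π → Irrelevant (S′ π)) →
              (∀ π → S π → S′ π) → (∀ π → S′ π → S π) → OfSize S n ↔ OfSize S′ n
OfSize-cong {S} {S′} S-irr S′-irr f g =
  mk↔ₛ′ (λ (π , s , p) → π , s , f π p) (λ (π , s , p) → π , s , g π p)
        (λ _ → OfSize-≡ {S′} S′-irr refl) (λ _ → OfSize-≡ {S} S-irr refl)

contribution : PartMult → ℕ
contribution p = mult p * part p

total : List PartMult → ℕ
total xs = sum (map contribution xs)

contribution≤total : ∀ {p xs} → p ∈ xs → contribution p ≤ total xs
contribution≤total {xs = x ∷ xs} (here refl)   = m≤m+n (contribution x) (total xs)
contribution≤total {xs = x ∷ xs} (there p∈xs) = ≤-trans (contribution≤total p∈xs) (m≤n+m (total xs) (contribution x))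

length≤total : ∀ {xs} → All (λ p → 0 < contribution p) xs → length xs ≤ total xs
length≤total []           = z≤n
length≤total (pos ∷ poss) = +-mono-≤ pos (length≤total poss)

lists≤ : ∀ {A : Set} → ℕ → List A → List (List A)
lists≤ zero    as = [ [] ]
lists≤ (suc L) as = [] ∷ cartesianProductWith _∷_ as (lists≤ L as)

∈-lists≤ : ∀ {A : Set} {as : List A} L {xs} → length xs ≤ L → All (_∈ as) xs → xs ∈ lists≤ L as
∈-lists≤ zero    z≤n      []           = here refl
∈-lists≤ (suc L) z≤n      []           = here refl
∈-lists≤ (suc L) (s≤s le) (x∈ ∷ xs∈as) = there (∈-cartesianProductWith⁺ _∷_ x∈ (∈-lists≤ L le xs∈as))

candidates : ℕ → List (List PartMult)
candidates n = lists≤ n (cartesianProduct (upTo (suc n)) (upTo (suc n)))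

∈-candidates : ∀ {xs} → Valid xs → xs ∈ candidates (total xs)
∈-candidates {xs} v = ∈-lists≤ (total xs) (length≤total (All.tabulate pos)) (All.tabulate bounded)
  where
  open Valid v
  part≤ : ∀ {p} → p ∈ xs → part p ≤ contribution p
  part≤ p∈xs = m≤n*m _ _ {{>-nonZero (All.lookup multsPos p∈xs)}}
  mult≤ : ∀ {p} → p ∈ xs → mult p ≤ contribution p
  mult≤ p∈xs = m≤m*n _ _ {{>-nonZero (All.lookup partsPos p∈xs)}}
  pos : ∀ {p} → p ∈ xs → 0 < contribution p
  pos p∈xs = ≤-trans (All.lookup partsPos p∈xs) (part≤ p∈xs)
  bounded : ∀ {p} → p ∈ xs → p ∈ cartesianProduct (upTo (suc (total xs))) (upTo (suc (total xs)))
  bounded p∈xs = ∈-cartesianProduct⁺ (∈-upTo⁺ (s≤s (≤-trans (part≤ p∈xs) (contribution≤total p∈xs))))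
                                     (∈-upTo⁺ (s≤s (≤-trans (mult≤ p∈xs) (contribution≤total p∈xs))))

OfSize-finite : ∀ {S : Partition → Set} → (∀ π → Dec (S π)) → (∀ π → Irrelevant (S π)) →
                ∀ n → Finite (OfSize S n)
OfSize-finite {S} S? S-irrelevant n =
  finite-↔ (↔-sym Σ-assoc) (finite-Σ (≡-dec (Product.≡-dec _≟_ _≟_)) (candidates n) Q? Q-irrelevant covered)
  where
  Q : List PartMult → Set
  Q xs = Σ[ v ∈ Valid xs ] (size (xs , v) ≡ n × S (xs , v))

  Q? : ∀ xs → Dec (Q xs)
  Q? xs with valid? xs
  ... | no ¬v = no (λ (v , _) → ¬v v)
  ... | yes v = map′ (v ,_) (λ (v′ , q) → subst (λ w → size (xs , w) ≡ n × S (xs , w)) (Valid-irrelevant v′ v) q)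
                     (total xs ≟ n ×-dec S? (xs , v))

  Q-irrelevant : ∀ {xs} → Irrelevant (Q xs)
  Q-irrelevant (v , s , p) (v′ , s′ , p′) with Valid-irrelevant v v′
  ... | refl = cong₂ (λ s p → v , s , p) (≡-irrelevant s s′) (S-irrelevant _ p p′)

  covered : ∀ {xs} → Q xs → xs ∈ candidates n
  covered (v , refl , _) = ∈-candidates v

-- Chains of distinct parts

data Descending : ℕ → List ℕ → ℕ → Set where
  done : ∀ {a z} → z < a → Descending a [] z
  step : ∀ {a b ms z} → b < a → Descending b ms z → Descending a (b ∷ ms) z

Descending-irrelevant : ∀ {a ms z} → Irrelevant (Descending a ms z)
Descending-irrelevant (done p)  (done q)  = cong done (<-irrelevant p q)
Descending-irrelevant (step p ds) (step q es) = cong₂ step (<-irrelevant p q) (Descending-irrelevant ds es)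

Descending⇒bottom<top : ∀ {a ms z} → Descending a ms z → z < a
Descending⇒bottom<top (done z<a)  = z<a
Descending⇒bottom<top (step b<a ds) = <-trans (Descending⇒bottom<top ds) b<a

Descending-raise : ∀ {a a′ ms z} → a ≤ a′ → Descending a ms z → Descending a′ ms z
Descending-raise a≤a′ (done z<a)  = done (<-≤-trans z<a a≤a′)
Descending-raise a≤a′ (step b<a ds) = step (<-≤-trans b<a a≤a′) ds

Descending-∷ʳ : ∀ {a ms z y} → Descending a ms z → y < z → Descending a (ms ++ [ z ]) y
Descending-∷ʳ (done z<a)    y<z = step z<a (done y<z)
Descending-∷ʳ (step b<a ds) y<z = step b<a (Descending-∷ʳ ds y<z)

splitLast : ℕ → List ℕ → List ℕ × ℕ
splitLast a []       = [] , a
splitLast a (b ∷ ms) = a ∷ proj₁ (splitLast b ms) , proj₂ (splitLast b ms)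

splitLast-∷ʳ : ∀ a ms z → splitLast a (ms ++ [ z ]) ≡ (a ∷ ms , z)
splitLast-∷ʳ a []       z = refl
splitLast-∷ʳ a (b ∷ ms) z rewrite splitLast-∷ʳ b ms z = refl

splitLast-++ : ∀ a ms → a ∷ ms ≡ proj₁ (splitLast a ms) ++ [ proj₂ (splitLast a ms) ]
splitLast-++ a []       = refl
splitLast-++ a (b ∷ ms) = cong (a ∷_) (splitLast-++ b ms)

sum-splitLast : ∀ a ms → sum (proj₁ (splitLast a ms)) + proj₂ (splitLast a ms) ≡ a + sum ms
sum-splitLast a ms = begin
  sum init + last            ≡⟨ cong (sum init +_) (+-identityʳ last) ⟨
  sum init + sum [ last ]    ≡⟨ sum-++ init [ last ] ⟨
  sum (init ++ [ last ])     ≡⟨ cong sum (splitLast-++ a ms) ⟨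
  a + sum ms                 ∎
  where open ≡-Reasoning
        init = proj₁ (splitLast a ms)
        last = proj₂ (splitLast a ms)

Descending-splitLast : ∀ {t a ms z} → a < t → Descending a ms z →
                       Descending t (proj₁ (splitLast a ms)) (proj₂ (splitLast a ms))
Descending-splitLast a<t (done _)   = done a<t
Descending-splitLast a<t (step b<a ds) = step a<t (Descending-splitLast b<a ds)

bottom<last : ∀ {a ms z} → Descending a ms z → z < proj₂ (splitLast a ms)
bottom<last (done z<a)  = z<a
bottom<last (step _ ds) = bottom<last ds

record Chain : Set where
  constructor chain
  field
    top        : ℕ
    middle     : List ℕ
    bottom     : ℕ
    descending : Descending top middle bottom
    bottom>0   : 0 < bottom

weight : ℕ → ℕ → Chain → ℕ
weight i j (chain a ms z _ _) = i * a + (sum ms + j * z)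

Chains : ℕ → ℕ → ℕ → Set
Chains i j n = Σ[ c ∈ Chain ] weight i j c ≡ n

chain-≡ : ∀ {a a′ ms ms′ z z′} {ds : Descending a ms z} {ds′ : Descending a′ ms′ z′} {p p′} →
          a ≡ a′ → ms ≡ ms′ → z ≡ z′ → chain a ms z ds p ≡ chain a′ ms′ z′ ds′ p′
chain-≡ refl refl refl = cong₂ (chain _ _ _) (Descending-irrelevant _ _) (<-irrelevant _ _)

Chains-≡ : ∀ {i j n} {x y : Chains i j n} → proj₁ x ≡ proj₁ y → x ≡ y
Chains-≡ {x = c , p} {y = .c , q} refl = cong (c ,_) (≡-irrelevant p q)

-- Splitting a chain according to its excess

Doubled : ℕ → Set
Doubled n = Chains 2 1 n ⊎ (Chains 1 2 n ⊎ (Chains 2 2 n ⊎ 3 ∣ n))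

top-≡ : ∀ {T T′ r n} → T′ ≡ T → 1 * T + r ≡ n → 1 * T′ + r ≡ n
top-≡ refl w = w

triple-weight : ∀ z → z * 3 ≡ 1 * (z + z) + (0 + 1 * z)
triple-weight = solve-∀

m<o∸n⇒n<o∸m : ∀ {m n o} → n ≤ o → m < o ∸ n → n < o ∸ m
m<o∸n⇒n<o∸m {m} {n} {o} n≤o m<o∸n =
  m+n≤o⇒m≤o∸n (suc n) (subst (_≤ o) (cong suc (+-comm m n)) (m≤o∸n⇒m+n≤o (suc m) n≤o m<o∸n))

z<a+z∸b : ∀ {a b z} → b < a → z < a + z ∸ b
z<a+z∸b {a} {b} {z} b<a = m+n≤o⇒m≤o∸n (suc z) (subst (_< a + z) (+-comm b z) (+-monoˡ-< z b<a))

quotient>0 : ∀ {m n} → 1 ≤ n → (m∣n : m ∣ n) → 0 < _∣_.quotient m∣n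
quotient>0 {n = suc _} _ (divides (suc _) _) = s≤s z≤n

decompose-pair : ∀ {n} T z → z < T → 0 < z → 1 * T + (0 + 1 * z) ≡ n →
                 Tri (T ∸ z < z) (T ∸ z ≡ z) (z < T ∸ z) → Doubled n
decompose-pair T z z<T z>0 w (tri< d<z _ _) =
  inj₁ (chain z [] (T ∸ z) (done d<z) (m<n⇒0<n∸m z<T) , trans (E0-weight (T ∸ z) z) (top-≡ (m∸n+n≡m (<⇒≤ z<T)) w))
  where E0-weight : ∀ d z → 2 * z + (0 + 1 * d) ≡ 1 * (d + z) + (0 + 1 * z)
        E0-weight = solve-∀
decompose-pair T z z<T z>0 w (tri≈ _ d≡z _) =
  inj₂ (inj₂ (inj₂ (divides z (sym (trans (triple-weight z) (top-≡ z+z≡T w))))))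
  where z+z≡T = trans (cong (_+ z) (sym d≡z)) (m∸n+n≡m (<⇒≤ z<T))
decompose-pair T z z<T z>0 w (tri> _ _ z<d) =
  inj₂ (inj₁ (chain (T ∸ z) [] z (done z<d) z>0 , trans (E1-weight (T ∸ z) z) (top-≡ (m∸n+n≡m (<⇒≤ z<T)) w)))
  where E1-weight : ∀ d z → 1 * d + (0 + 2 * z) ≡ 1 * (d + z) + (0 + 1 * z)
        E1-weight = solve-∀

decompose-long : ∀ {n} T b ms z → b < T → Descending b ms z → 0 < z → 1 * T + ((b + sum ms) + 1 * z) ≡ n →
                 Tri (T ∸ b < z) (T ∸ b ≡ z) (z < T ∸ b) → Doubled n
decompose-long T b ms z b<T ds z>0 w (tri< d<z _ _) =
  inj₁ (chain b (ms ++ [ z ]) (T ∸ b) (Descending-∷ʳ ds d<z) (m<n⇒0<n∸m b<T) ,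
        trans (cong (λ s → 2 * b + (s + 1 * (T ∸ b))) (sum-++ ms [ z ]))
              (trans (E0-weight (T ∸ b) b z (sum ms)) (top-≡ (m∸n+n≡m (<⇒≤ b<T)) w)))
  where E0-weight : ∀ d b z s → 2 * b + ((s + (z + 0)) + 1 * d) ≡ 1 * (d + b) + ((b + s) + 1 * z)
        E0-weight = solve-∀
decompose-long T b ms z b<T ds z>0 w (tri≈ _ d≡z _) =
  inj₂ (inj₂ (inj₁ (chain b ms z ds z>0 ,
    trans (ED-weight b z (sum ms)) (top-≡ (trans (cong (_+ b) (sym d≡z)) (m∸n+n≡m (<⇒≤ b<T))) w))))
  where ED-weight : ∀ b z s → 2 * b + (s + 2 * z) ≡ 1 * (z + b) + ((b + s) + 1 * z)
        ED-weight = solve-∀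
decompose-long T b ms z b<T ds z>0 w (tri> _ _ z<d) =
  inj₂ (inj₁ (chain (T ∸ z) (b ∷ ms) z (step (m<o∸n⇒n<o∸m (<⇒≤ b<T) z<d) ds) z>0 ,
    trans (E1-weight (T ∸ z) b z (sum ms)) (top-≡ (m∸n+n≡m (<⇒≤ z<T)) w)))
  where E1-weight : ∀ e b z s → 1 * e + ((b + s) + 2 * z) ≡ 1 * (e + z) + ((b + s) + 1 * z)
        E1-weight = solve-∀
        z<T : z < T
        z<T = <-≤-trans z<d (m∸n≤m T b)

-- The excess d of a chain is T ∸ b, resp. T ∸ z for two parts; it never truncates since b < T.
decompose : ∀ {n} → Chains 1 1 n → Doubled n
decompose (chain T []       z (done z<T)  z>0 , w) = decompose-pair T z z<T z>0 w (<-cmp (T ∸ z) z)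
decompose (chain T (b ∷ ms) z (step b<T ds) z>0 , w) = decompose-long T b ms z b<T ds z>0 w (<-cmp (T ∸ b) z)

recompose : ∀ {n} → 1 ≤ n → Doubled n → Chains 1 1 n
recompose _ (inj₁ (chain a ms z ds z>0 , w)) =
  chain (a + z) (proj₁ (splitLast a ms)) (proj₂ (splitLast a ms))
        (Descending-splitLast (m<m+n a z>0) ds) (<-trans z>0 (bottom<last ds)) ,
  trans (E0-weight a z (sum (proj₁ (splitLast a ms))) (proj₂ (splitLast a ms)) (sum ms) (sum-splitLast a ms)) w
  where E0-weight : ∀ a z s l σ → s + l ≡ a + σ → 1 * (a + z) + (s + 1 * l) ≡ 2 * a + (σ + 1 * z)
        E0-weight a z s l σ eq = begin
          1 * (a + z) + (s + 1 * l) ≡⟨ cong (λ t → 1 * (a + z) + (s + t)) (*-identityˡ l) ⟩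
          1 * (a + z) + (s + l)     ≡⟨ cong (1 * (a + z) +_) eq ⟩
          1 * (a + z) + (a + σ)     ≡⟨ regroup a z σ ⟩
          2 * a + (σ + 1 * z)       ∎
          where
          open ≡-Reasoning
          regroup : ∀ a z σ → 1 * (a + z) + (a + σ) ≡ 2 * a + (σ + 1 * z)
          regroup = solve-∀
recompose _ (inj₂ (inj₁ (chain a ms z ds z>0 , w))) =
  chain (a + z) ms z (Descending-raise (m≤m+n a z) ds) z>0 , trans (E1-weight a z (sum ms)) w
  where E1-weight : ∀ a z s → 1 * (a + z) + (s + 1 * z) ≡ 1 * a + (s + 2 * z)
        E1-weight = solve-∀
recompose _ (inj₂ (inj₂ (inj₁ (chain a ms z ds z>0 , w)))) =
  chain (a + z) (a ∷ ms) z (step (m<m+n a z>0) ds) z>0 , trans (ED-weight a z (sum ms)) w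
  where ED-weight : ∀ a z s → 1 * (a + z) + ((a + s) + 1 * z) ≡ 2 * a + (s + 2 * z)
        ED-weight = solve-∀
recompose n≥1 (inj₂ (inj₂ (inj₂ k∣n@(divides k n≡k*3)))) =
  chain (k + k) [] k (done (m<m+n k (quotient>0 n≥1 k∣n))) (quotient>0 n≥1 k∣n) ,
  sym (trans n≡k*3 (triple-weight k))

recompose-decompose : ∀ {n} (n≥1 : 1 ≤ n) (x : Chains 1 1 n) → recompose n≥1 (decompose x) ≡ x
recompose-decompose n≥1 (chain T [] z (done z<T) z>0 , w) with <-cmp (T ∸ z) z | m∸n+n≡m (<⇒≤ z<T)
... | tri< _ _ _   | d+z≡T = Chains-≡ {1} {1} (chain-≡ (trans (+-comm z (T ∸ z)) d+z≡T) refl refl)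
... | tri≈ _ d≡z _ | d+z≡T = Chains-≡ {1} {1} (chain-≡ (trans (cong (_+ z) (sym d≡z)) d+z≡T) refl refl)
... | tri> _ _ _   | d+z≡T = Chains-≡ {1} {1} (chain-≡ d+z≡T refl refl)
recompose-decompose n≥1 (chain T (b ∷ ms) z (step b<T ds) z>0 , w) with <-cmp (T ∸ b) z | m∸n+n≡m (<⇒≤ b<T)
... | tri< _ _ _   | d+b≡T = Chains-≡ {1} {1} (chain-≡ (trans (+-comm b (T ∸ b)) d+b≡T)
                                               (cong proj₁ (splitLast-∷ʳ b ms z)) (cong proj₂ (splitLast-∷ʳ b ms z)))
... | tri≈ _ d≡z _ | d+b≡T =
  Chains-≡ {1} {1} (chain-≡ (trans (+-comm b z) (trans (cong (_+ b) (sym d≡z)) d+b≡T)) refl refl)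
... | tri> _ _ z<d | _     = Chains-≡ {1} {1} (chain-≡ (m∸n+n≡m (<⇒≤ (<-≤-trans z<d (m∸n≤m T b)))) refl refl)

decompose-recompose : ∀ {n} (n≥1 : 1 ≤ n) (x : Doubled n) → decompose (recompose n≥1 x) ≡ x
decompose-recompose n≥1 (inj₁ (chain a [] z (done z<a) z>0 , w)) with <-cmp (a + z ∸ a) a
... | tri< _ _ _   = cong inj₁ (Chains-≡ {2} {1} (chain-≡ refl refl (m+n∸m≡n a z)))
... | tri≈ ¬d<a _ _ = contradiction (subst (_< a) (sym (m+n∸m≡n a z)) z<a) ¬d<a
... | tri> ¬d<a _ _ = contradiction (subst (_< a) (sym (m+n∸m≡n a z)) z<a) ¬d<a
decompose-recompose n≥1 (inj₁ (chain a (b ∷ ms) z (step b<a ds) z>0 , w)) with <-cmp (a + z ∸ a) (proj₂ (splitLast b ms))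
... | tri< _ _ _    = cong inj₁ (Chains-≡ {2} {1} (chain-≡ refl (sym (splitLast-++ b ms)) (m+n∸m≡n a z)))
... | tri≈ ¬d<l _ _ = contradiction (subst (_< _) (sym (m+n∸m≡n a z)) (bottom<last ds)) ¬d<l
... | tri> ¬d<l _ _ = contradiction (subst (_< _) (sym (m+n∸m≡n a z)) (bottom<last ds)) ¬d<l
decompose-recompose n≥1 (inj₂ (inj₁ (chain a [] z (done z<a) z>0 , w))) with <-cmp (a + z ∸ z) z
... | tri> _ _ _    = cong (inj₂ ∘ inj₁) (Chains-≡ {1} {2} (chain-≡ (m+n∸n≡m a z) refl refl))
... | tri< _ _ ¬z<d = contradiction (subst (z <_) (sym (m+n∸n≡m a z)) z<a) ¬z<d
... | tri≈ _ _ ¬z<d = contradiction (subst (z <_) (sym (m+n∸n≡m a z)) z<a) ¬z<d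
decompose-recompose n≥1 (inj₂ (inj₁ (chain a (b ∷ ms) z (step b<a ds) z>0 , w))) with <-cmp (a + z ∸ b) z
... | tri> _ _ _    = cong (inj₂ ∘ inj₁) (Chains-≡ {1} {2} (chain-≡ (m+n∸n≡m a z) refl refl))
... | tri< _ _ ¬z<d = contradiction (z<a+z∸b b<a) ¬z<d
... | tri≈ _ _ ¬z<d = contradiction (z<a+z∸b b<a) ¬z<d
decompose-recompose n≥1 (inj₂ (inj₂ (inj₁ (chain a ms z ds z>0 , w)))) with <-cmp (a + z ∸ a) z
... | tri≈ _ _ _   = cong (inj₂ ∘ inj₂ ∘ inj₁) (Chains-≡ {2} {2} refl)
... | tri< _ d≢z _ = contradiction (m+n∸m≡n a z) d≢z
... | tri> _ d≢z _ = contradiction (m+n∸m≡n a z) d≢z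
decompose-recompose n≥1 (inj₂ (inj₂ (inj₂ (divides k n≡k*3)))) with <-cmp (k + k ∸ k) k
... | tri≈ _ _ _   = cong (inj₂ ∘ inj₂ ∘ inj₂ ∘ divides k) (≡-irrelevant _ _)
... | tri< _ d≢k _ = contradiction (m+n∸n≡m k k) d≢k
... | tri> _ d≢k _ = contradiction (m+n∸n≡m k k) d≢k

Chains11↔Doubled : ∀ {n} → 1 ≤ n → Chains 1 1 n ↔ Doubled n
Chains11↔Doubled n≥1 = mk↔ₛ′ decompose (recompose n≥1) (decompose-recompose n≥1) (recompose-decompose n≥1)

-- Partitions with prescribed end multiplicities as chains

HasEndMults : ℕ → ℕ → Partition → Set
HasEndMults i j π = 2 ≤ dim π × mults π ≡ i ∷ (replicate (dim π ∸ 2) 1 ++ [ j ])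

HasEndMults-irrelevant : ∀ i j π → Irrelevant (HasEndMults i j π)
HasEndMults-irrelevant i j π = ≤×≡-irrelevant

Decreasing : List PartMult → Set
Decreasing = Linked (λ p q → part q < part p)

below : ℕ → List ℕ → ℕ → List PartMult
below j ms z = map (_, 1) ms ++ [ (z , j) ]

withMults : ℕ → ℕ → Chain → List PartMult
withMults i j (chain a ms z _ _) = (a , i) ∷ below j ms z

length-below : ∀ j ms z → length (below j ms z) ≡ suc (length ms)
length-below j []       z = refl
length-below j (b ∷ ms) z = cong suc (length-below j ms z)

mults-below : ∀ j ms z → map mult (below j ms z) ≡ replicate (length ms) 1 ++ [ j ]
mults-below j []       z = refl
mults-below j (b ∷ ms) z = cong (1 ∷_) (mults-below j ms z)

parts-below : ∀ j ms z → map part (below j ms z) ≡ ms ++ [ z ]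
parts-below j []       z = refl
parts-below j (b ∷ ms) z = cong (b ∷_) (parts-below j ms z)

total-below : ∀ j ms z → total (below j ms z) ≡ sum ms + j * z
total-below j []       z = +-identityʳ (j * z)
total-below j (b ∷ ms) z = trans (cong₂ _+_ (+-identityʳ b) (total-below j ms z)) (sym (+-assoc b (sum ms) (j * z)))

total-withMults : ∀ i j c → total (withMults i j c) ≡ weight i j c
total-withMults i j (chain a ms z _ _) = cong (i * a +_) (total-below j ms z)

withMults-valid : ∀ {i j} → 0 < i → 0 < j → ∀ c → Valid (withMults i j c)
withMults-valid {i} {j} i>0 j>0 (chain a ms z ds z>0) = record
  { dimPos = s≤s z≤n ; decr = decreasing ds ; partsPos = parts>0 ds ; multsPos = mults>0 i>0 ms }
  where
  decreasing : ∀ {i a ms} → Descending a ms z → Decreasing ((a , i) ∷ below j ms z)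
  decreasing (done z<a)  = z<a ∷ [-]
  decreasing (step b<a ds) = b<a ∷ decreasing ds
  parts>0 : ∀ {i a ms} → Descending a ms z → All (λ p → 0 < part p) ((a , i) ∷ below j ms z)
  parts>0 (done z<a)       = <-trans z>0 z<a ∷ z>0 ∷ []
  parts>0 ds@(step _ ds′) = <-trans z>0 (Descending⇒bottom<top ds) ∷ parts>0 ds′
  mults>0 : ∀ {i a} → 0 < i → ∀ ms → All (λ p → 0 < mult p) ((a , i) ∷ below j ms z)
  mults>0 i>0 []       = i>0 ∷ j>0 ∷ []
  mults>0 i>0 (b ∷ ms) = i>0 ∷ mults>0 (s≤s z≤n) ms

descending-tail : ∀ p q rest → Decreasing (p ∷ q ∷ rest) →
                  Descending (part p) (proj₁ (splitLast (part q) (map part rest))) (proj₂ (splitLast (part q) (map part rest)))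
descending-tail p q []         (q<p ∷ _) = done q<p
descending-tail p q (r ∷ rest) (q<p ∷ l) = step q<p (descending-tail q r rest l)

last>0 : ∀ q rest → All (λ p → 0 < part p) (q ∷ rest) → 0 < proj₂ (splitLast (part q) (map part rest))
last>0 q []         (q>0 ∷ _)  = q>0
last>0 q (r ∷ rest) (_ ∷ rest>0) = last>0 r rest rest>0

chainOf : ∀ p q rest → Valid (p ∷ q ∷ rest) → Chain
chainOf p q rest v = chain (part p) _ _ (descending-tail p q rest decr) (last>0 q rest (All.tail partsPos))
  where open Valid v

≡-below : ∀ j q rest → map mult (q ∷ rest) ≡ replicate (length rest) 1 ++ [ j ] →
          q ∷ rest ≡ below j (proj₁ (splitLast (part q) (map part rest))) (proj₂ (splitLast (part q) (map part rest)))
≡-below j q []         m = cong (λ k → (part q , k) ∷ []) (∷-injectiveˡ m)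
≡-below j q (r ∷ rest) m = cong₂ _∷_ (cong (part q ,_) (∷-injectiveˡ m)) (≡-below j r rest (∷-injectiveʳ m))

≡-withMults : ∀ i j p q rest (v : Valid (p ∷ q ∷ rest)) →
              map mult (p ∷ q ∷ rest) ≡ i ∷ (replicate (length rest) 1 ++ [ j ]) →
              p ∷ q ∷ rest ≡ withMults i j (chainOf p q rest v)
≡-withMults i j p q rest v m = cong₂ _∷_ (cong (part p ,_) (∷-injectiveˡ m)) (≡-below j q rest (∷-injectiveʳ m))

HasEndMults↔Chains : ∀ {i j n} → 0 < i → 0 < j → OfSize (HasEndMults i j) n ↔ Chains i j n
HasEndMults↔Chains {i} {j} {n} i>0 j>0 = mk↔ₛ′ to from to∘from from∘to
  where
  to : OfSize (HasEndMults i j) n → Chains i j n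
  to ((p ∷ q ∷ rest , v) , s , _ , m) =
    c , trans (sym (trans (cong total (≡-withMults i j p q rest v m)) (total-withMults i j c))) s
    where c = chainOf p q rest v
  to (([] , _)     , _ , ()      , _)
  to ((_ ∷ [] , _) , _ , s≤s () , _)

  from : Chains i j n → OfSize (HasEndMults i j) n
  from (c@(chain a ms z _ _) , w) =
    (withMults i j c , withMults-valid i>0 j>0 c) , trans (total-withMults i j c) w ,
    subst (λ l → 2 ≤ suc l) (sym (length-below j ms z)) (s≤s (s≤s z≤n)) ,
    cong (i ∷_) (trans (mults-below j ms z) (cong (λ l → replicate (l ∸ 1) 1 ++ [ j ]) (sym (length-below j ms z))))

  to∘from : ∀ x → to (from x) ≡ x
  to∘from (chain a []       z (done _) _ , _) = Chains-≡ {i} {j} (chain-≡ refl refl refl)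
  to∘from (chain a (b ∷ ms) z (step _ _) _ , _) = Chains-≡ {i} {j} (chain-≡ refl (cong proj₁ eq) (cong proj₂ eq))
    where eq = trans (cong (splitLast b) (parts-below j ms z)) (splitLast-∷ʳ b ms z)

  from∘to : ∀ x → from (to x) ≡ x
  from∘to ((p ∷ q ∷ rest , v) , s , _ , m) = OfSize-≡ (HasEndMults-irrelevant i j) (sym (≡-withMults i j p q rest v m))
  from∘to (([] , _)     , _ , ()      , _)
  from∘to ((_ ∷ [] , _) , _ , s≤s () , _)

replicate-∷ʳ : ∀ {A : Set} L (x : A) → replicate (suc L) x ≡ replicate L x ++ [ x ]
replicate-∷ʳ zero    x = refl
replicate-∷ʳ (suc L) x = cong (x ∷_) (replicate-∷ʳ L x)

InE0⇒HasEndMults : ∀ π → InE0 π → HasEndMults 2 1 π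
InE0⇒HasEndMults (p ∷ q ∷ rest , _) (d , m) = d , trans m (cong (2 ∷_) (replicate-∷ʳ (length rest) 1))
InE0⇒HasEndMults ([] , _)           (() , _)
InE0⇒HasEndMults (_ ∷ [] , _)       (s≤s () , _)

HasEndMults⇒InE0 : ∀ π → HasEndMults 2 1 π → InE0 π
HasEndMults⇒InE0 (p ∷ q ∷ rest , _) (d , m) = d , trans m (cong (2 ∷_) (sym (replicate-∷ʳ (length rest) 1)))
HasEndMults⇒InE0 ([] , _)           (() , _)
HasEndMults⇒InE0 (_ ∷ [] , _)       (s≤s () , _)

InE1⇒HasEndMults : ∀ π → InE1 π → HasEndMults 1 2 π
InE1⇒HasEndMults (p ∷ q ∷ rest , _) e = e
InE1⇒HasEndMults ([] , _)           (() , _)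
InE1⇒HasEndMults (_ ∷ [] , _)       (s≤s () , _)

HasEndMults⇒InE1 : ∀ π → HasEndMults 1 2 π → InE1 π
HasEndMults⇒InE1 (p ∷ q ∷ rest , _) e = e
HasEndMults⇒InE1 ([] , _)           (() , _)
HasEndMults⇒InE1 (_ ∷ [] , _)       (s≤s () , _)

InE0-irrelevant : ∀ π → Irrelevant (InE0 π)
InE0-irrelevant π = ≤×≡-irrelevant

InE1-irrelevant : ∀ π → Irrelevant (InE1 π)
InE1-irrelevant π = ≤×≡-irrelevant

E0↔Chains : ∀ {n} → OfSize InE0 n ↔ Chains 2 1 n
E0↔Chains = HasEndMults↔Chains (s≤s z≤n) (s≤s z≤n) ↔-∘
            OfSize-cong InE0-irrelevant (HasEndMults-irrelevant 2 1) InE0⇒HasEndMults HasEndMults⇒InE0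

E1↔Chains : ∀ {n} → OfSize InE1 n ↔ Chains 1 2 n
E1↔Chains = HasEndMults↔Chains (s≤s z≤n) (s≤s z≤n) ↔-∘
            OfSize-cong InE1-irrelevant (HasEndMults-irrelevant 1 2) InE1⇒HasEndMults HasEndMults⇒InE1

ED↔Chains : ∀ {n} → OfSize InED n ↔ Chains 2 2 n
ED↔Chains = HasEndMults↔Chains (s≤s z≤n) (s≤s z≤n)

InD↔⊤⊎HasEndMults : ∀ {n} → 1 ≤ n → OfSize InD n ↔ (⊤ ⊎ OfSize (HasEndMults 1 1) n)
InD↔⊤⊎HasEndMults {n} n≥1 = mk↔ₛ′ to from to∘from from∘to
  where
  to : OfSize InD n → ⊤ ⊎ OfSize (HasEndMults 1 1) n
  to ((p ∷ q ∷ rest , v) , s , m) =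
    inj₂ ((p ∷ q ∷ rest , v) , s , s≤s (s≤s z≤n) , trans m (cong (1 ∷_) (replicate-∷ʳ (length rest) 1)))
  to ((_ ∷ [] , _) , _)          = inj₁ tt
  to (([] , record { dimPos = () }) , _)

  single : Valid [ (n , 1) ]
  single = record { dimPos = s≤s z≤n ; decr = [-] ; partsPos = n≥1 ∷ [] ; multsPos = s≤s z≤n ∷ [] }

  from : ⊤ ⊎ OfSize (HasEndMults 1 1) n → OfSize InD n
  from (inj₁ tt) = ([ (n , 1) ] , single) , trans (+-identityʳ _) (+-identityʳ n) , refl
  from (inj₂ ((p ∷ q ∷ rest , v) , s , _ , m)) =
    (p ∷ q ∷ rest , v) , s , trans m (cong (1 ∷_) (sym (replicate-∷ʳ (length rest) 1)))
  from (inj₂ (([] , _)     , _ , ()      , _))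
  from (inj₂ ((_ ∷ [] , _) , _ , s≤s () , _))

  to∘from : ∀ x → to (from x) ≡ x
  to∘from (inj₁ tt) = refl
  to∘from (inj₂ ((p ∷ q ∷ rest , v) , s , _ , m)) = cong inj₂ (OfSize-≡ (HasEndMults-irrelevant 1 1) refl)
  to∘from (inj₂ (([] , _)     , _ , ()      , _))
  to∘from (inj₂ ((_ ∷ [] , _) , _ , s≤s () , _))

  from∘to : ∀ x → from (to x) ≡ x
  from∘to ((p ∷ q ∷ rest , v) , s , m) = OfSize-≡ (λ _ → List≡-irrelevant) refl
  from∘to (((x , 1) ∷ [] , v) , s , refl) =
    OfSize-≡ (λ _ → List≡-irrelevant) (cong (λ y → [ (y , 1) ]) (trans (sym s) x+0+0≡x))
    where x+0+0≡x = trans (+-identityʳ _) (+-identityʳ x)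
  from∘to (([] , record { dimPos = () }) , _)

∣-irrelevant : ∀ {m n} .{{_ : NonZero m}} → Irrelevant (m ∣ n)
∣-irrelevant {m} (divides q n≡q*m) (divides q′ n≡q′*m) with *-cancelʳ-≡ q q′ m (trans (sym n≡q*m) n≡q′*m)
... | refl = cong (divides q) (≡-irrelevant n≡q*m n≡q′*m)

distinct↔ : ∀ {n} → 1 ≤ n → OfSize InD n ↔ (⊤ ⊎ (OfSize InE0 n ⊎ (OfSize InE1 n ⊎ (OfSize InED n ⊎ 3 ∣ n))))
distinct↔ n≥1 =
  (↔-id _ ⊎-↔ (↔-sym E0↔Chains ⊎-↔ (↔-sym E1↔Chains ⊎-↔ (↔-sym ED↔Chains ⊎-↔ ↔-id _)))) ↔-∘
  ((↔-id _ ⊎-↔ (Chains11↔Doubled n≥1 ↔-∘ HasEndMults↔Chains (s≤s z≤n) (s≤s z≤n))) ↔-∘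
   InD↔⊤⊎HasEndMults n≥1)

mainTheorem11 : (n : ℕ) → 1 ≤ n →
    Σ[ d ∈ ℕ ] Σ[ e0 ∈ ℕ ] Σ[ e1 ∈ ℕ ] Σ[ eD ∈ ℕ ]
      (OfSize InD n HasCard d) × (OfSize InE0 n HasCard e0) ×
      (OfSize InE1 n HasCard e1) × (OfSize InED n HasCard eD) ×
      (d ≡ 1 + e0 + e1 + eD + δ n)
mainTheorem11 n n≥1 =
  let d  , D  = OfSize-finite (λ π → ≡-dec _≟_ _ _) (λ _ → List≡-irrelevant) n
      e0 , E0 = OfSize-finite (λ π → 2 ≤? dim π ×-dec ≡-dec _≟_ _ _) InE0-irrelevant n
      e1 , E1 = OfSize-finite (λ π → 2 ≤? dim π ×-dec ≡-dec _≟_ _ _) InE1-irrelevant n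
      eD , ED = OfSize-finite (λ π → 2 ≤? dim π ×-dec ≡-dec _≟_ _ _) (HasEndMults-irrelevant 2 2) n
      δ↔ = Fin-if-does↔ (3 ∣? n) ∣-irrelevant
      counting = ↔-sym (Fin+↔⊎ 1↔⊤ (Fin+↔⊎ E0 (Fin+↔⊎ E1 (Fin+↔⊎ ED δ↔)))) ↔-∘
                 (distinct↔ n≥1 ↔-∘ D)
  in d , e0 , e1 , eD , D , E0 , E1 , ED , trans (↔⇒≡ counting) (+-reassoc e0 e1 eD (δ n))
  where
  +-reassoc : ∀ a b c e → 1 + (a + (b + (c + e))) ≡ 1 + a + b + c + e
  +-reassoc = solve-∀
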